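{- Let $A$ be an open parity game, $i$ an entrance, and $q,q'$ queries on $A$. Then $q=q'$ iff $q^\ast=q'^\ast$. Moreover, $q\sqsubseteq q'$ (query order) iff $q'^\ast\preceq_{\mathcal R}q^\ast$.
   Context: Fix priorities $\mathbb{P}=\{0,1,\dots,M\}$ with $M\ge 2$ even. An open parity game $A$ has a set $O$ of exits (and entrances, nodes, edges with priorities in $\mathbb{P}$). Domain $D(A)=\{\bot,\top\}\cup(O\times\mathbb{P})$. Sub-priority order $\preceq_{\mathbb P}$: the total order $M-1\prec M-3\prec\cdots\prec1\prec0\prec2\prec\cdots\prec M$. Domain order: $d_1\preceq_D d_2$ iff $d_1=\bot$, or $d_2=\top$, or $d_1=(o,m_1),d_2=(o,m_2)$ for the same exit with $m_1\preceq_{\mathbb P}m_2$. A result is a nonempty $T\subseteq D(A)$ equal to its set of $\preceq_D$-minimal elements; the result order is $T_1\preceq_{\mathcal R}T_2$ iff every $d_2\in T_2$ has some $d_1\in T_1$ with $d_1\preceq_D d_2$. A query is a function $q\colon O\to\mathbb{P}\uplus\{\bot\}$. Extend $\preceq_{\mathbb P}$ to $\mathbb{P}\uplus\{\bot\}$ with $\bot$ least; the query order is pointwise: $q\sqsubseteq q'$ iff $q(o)\preceq q'(o)$ for all $o\in O$. Dual of a priority: $\overline m=m+1$ if $m$ odd, $\overline0=0$, $\overline m=m-1$ if $m$ even and $m>0$. Dual of a query: $q^\ast=\{\top\}$ if $q(o)=\bot$ for every $o\in O$; otherwise $q^\ast=\{(o,\overline{q(o)}):o\in O,\ q(o)\in\mathbb{P}\}$.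 -}

module Defs where

open import Data.Nat using (ℕ; zero; suc; _≤_; _<_; _+_; _∸_)
open import Data.Nat.Divisibility using (_∣_)
open import Data.Fin using (Fin; toℕ)
open import Data.Maybe using (Maybe; just; nothing)
open import Data.Product using (Σ; ∃; _×_; _,_)
open import Data.Sum using (_⊎_)
open import Relation.Binary.PropositionalEquality using (_≡_)
open import Relation.Nullary using (¬_)
open import Function.Bundles using (_⇔_)

Prio : ℕ → Set
Prio M = Fin (suc M)

Exit : ℕ → Set
Exit n = Fin n

Odd Even : ℕ → Set
Odd m = 2 ∣ suc m
Even m = 2 ∣ m

-- Sub-priority order on natural numbers:
-- M-1 ≺ M-3 ≺ … ≺ 1 ≺ 0 ≺ 2 ≺ … ≺ M, i.e. odd below even,
-- odds ordered decreasingly, evens ordered increasingly.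
_⊑ℕ_ : ℕ → ℕ → Set
m₁ ⊑ℕ m₂ = (Odd m₁ × Even m₂)
         ⊎ ((Odd m₁ × Odd m₂ × m₂ ≤ m₁)
         ⊎ (Even m₁ × Even m₂ × m₁ ≤ m₂))

_⪯P_ : ∀ {M} → Prio M → Prio M → Set
p ⪯P p' = toℕ p ⊑ℕ toℕ p'

-- Extension to P ⊎ {⊥} (Maybe, with nothing = ⊥ least).
_⪯P⊥_ : ∀ {M} → Maybe (Prio M) → Maybe (Prio M) → Set
nothing ⪯P⊥ _ = Data.Unit.⊤ where import Data.Unit
just p ⪯P⊥ nothing = Data.Empty.⊥ where import Data.Empty
just p ⪯P⊥ just p' = p ⪯P p'

data Dom (n M : ℕ) : Set where
  bot : Dom n M
  top : Dom n M
  pair : Exit n → Prio M → Dom n M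

data _⪯D_ {n M : ℕ} : Dom n M → Dom n M → Set where
  bot≤ : ∀ {d} → bot ⪯D d
  ≤top : ∀ {d} → d ⪯D top
  pair≤ : ∀ {o m₁ m₂} → m₁ ⪯P m₂ → pair o m₁ ⪯D pair o m₂

DSet : ℕ → ℕ → Set₁
DSet n M = Dom n M → Set

_⪯R_ : ∀ {n M} → DSet n M → DSet n M → Set
T₁ ⪯R T₂ = ∀ d₂ → T₂ d₂ → Σ _ (λ d₁ → T₁ d₁ × d₁ ⪯D d₂)

_≐_ : ∀ {n M} → DSet n M → DSet n M → Set
T₁ ≐ T₂ = ∀ d → T₁ d ⇔ T₂ d

Query : ℕ → ℕ → Set
Query n M = Exit n → Maybe (Prio M)

_⊑Q_ : ∀ {n M} → Query n M → Query n M → Set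
q ⊑Q q' = ∀ o → q o ⪯P⊥ q' o

-- Query equality (pointwise, since function extensionality is unavailable).
_≗Q_ : ∀ {n M} → Query n M → Query n M → Set
q ≗Q q' = ∀ o → q o ≡ q' o

dualℕ : ℕ → ℕ
dualℕ zero = zero
dualℕ (suc zero) = 2
dualℕ (suc (suc zero)) = 1
dualℕ (suc (suc (suc m))) = 2 + dualℕ (suc m)

-- Dual of a query, as a subset of D(A):
-- {⊤} if q is everywhere ⊥, otherwise {(o, dual (q o)) : q o ∈ P}.
-- (If q is everywhere ⊥ the pair-part is empty, so both cases are covered uniformly.)
dualQ : ∀ {n M} → Query n M → DSet n M
dualQ q bot = Data.Empty.⊥ where import Data.Empty
dualQ q top = ∀ o → q o ≡ nothing
dualQ q (pair o m) = Σ _ (λ p → (q o ≡ just p) × (toℕ m ≡ dualℕ (toℕ p)))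

-- Under the ranking m ↦ m for even m and m ↦ −(m+1) for odd m, the
-- sub-priority order becomes the order of ℤ and the dual of a priority
-- becomes negation; hence dualisation is an order-reversing involution,
-- which for even M maps {0,…,M} onto itself. The dual q* of a query lists,
-- for each exit o with q(o) ≠ ⊥, the single element (o, dual q(o)), so
-- q(o) = dual p iff (o, p) ∈ q*; the comparison of two duals therefore
-- happens exit by exit, the only other element being ⊤ (when q ≡ ⊥), which
-- lies above every element of the always nonempty set q'*.
module Submission where

open import Defs
open import Data.Nat using (ℕ; zero; suc; pred; _+_; _≤_; z≤n; s≤s)
open import Data.Nat.Properties using (≤-trans; pred[n]≤n; ≤∧≢⇒<)
open import Data.Nat.Divisibility using (_∣_; _∣0; ∣1⇒≡1; ∣-refl; ∣m∣n⇒∣m+n; ∣m+n∣m⇒∣n)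
open import Data.Fin using (Fin; zero; suc; toℕ; fromℕ<)
open import Data.Fin.Properties using (toℕ-fromℕ<; toℕ-injective; toℕ≤pred[n])
open import Data.Maybe using (Maybe; just; nothing)
open import Data.Product using (∃; ∃₂; _×_; _,_)
open import Data.Sum using (_⊎_; inj₁; inj₂)
open import Data.Unit using (tt)
open import Relation.Nullary using (¬_; contradiction)
open import Relation.Binary.PropositionalEquality
open import Function using (_∘_)
open import Function.Bundles using (_⇔_; mk⇔; Equivalence)

open Equivalence

pattern odd⊑even m₁-odd m₂-even = inj₁ (m₁-odd , m₂-even)
pattern odd⊑odd m₁-odd m₂-odd m₂≤m₁ = inj₂ (inj₁ (m₁-odd , m₂-odd , m₂≤m₁))
pattern even⊑even m₁-even m₂-even m₁≤m₂ = inj₂ (inj₂ (m₁-even , m₂-even , m₁≤m₂))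

-- 'Odd m' unfolds to 'Even (suc m)'; the proofs below use this freely.

even-0 : Even 0
even-0 = 2 ∣0

¬even-1 : ¬ Even 1
¬even-1 2∣1 with ∣1⇒≡1 2∣1
... | ()

even-2+ : ∀ {m} → Even (2 + m) ⇔ Even m
even-2+ = mk⇔ (λ 2∣2+m → ∣m+n∣m⇒∣n 2∣2+m ∣-refl) (∣m∣n⇒∣m+n ∣-refl)

even-or-odd : ∀ m → Even m ⊎ Odd m
even-or-odd zero = inj₁ even-0
even-or-odd (suc m) with even-or-odd m
... | inj₁ m-even = inj₂ (from even-2+ m-even)
... | inj₂ m-odd = inj₁ m-odd

even⇒¬odd : ∀ {m} → Even m → ¬ Odd m
even⇒¬odd {zero} _ = ¬even-1
even⇒¬odd {suc zero} 1-even _ = ¬even-1 1-even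
even⇒¬odd {suc (suc m)} m-even m-odd =
  even⇒¬odd (to even-2+ m-even) (to even-2+ m-odd)

dualℕ-odd : ∀ {m} → Odd m → dualℕ m ≡ suc m
dualℕ-odd {zero} 0-odd = contradiction 0-odd ¬even-1
dualℕ-odd {suc zero} _ = refl
dualℕ-odd {suc (suc zero)} 2-odd = contradiction (to even-2+ 2-odd) ¬even-1
dualℕ-odd {suc (suc (suc m))} 3+m-odd = cong (2 +_) (dualℕ-odd (to even-2+ 3+m-odd))

dualℕ-even : ∀ {m} → Even m → dualℕ m ≡ pred m
dualℕ-even {zero} _ = refl
dualℕ-even {suc zero} 1-even = contradiction 1-even ¬even-1
dualℕ-even {suc (suc zero)} _ = refl
dualℕ-even {suc (suc (suc m))} 3+m-even = cong (2 +_) (dualℕ-even (to even-2+ 3+m-even))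

dualℕ-involutive : ∀ m → dualℕ (dualℕ m) ≡ m
dualℕ-involutive zero = refl
dualℕ-involutive (suc m) with even-or-odd (suc m)
... | inj₁ 1+m-even = trans (cong dualℕ (dualℕ-even 1+m-even)) (dualℕ-odd 1+m-even)
... | inj₂ 1+m-odd = trans (cong dualℕ (dualℕ-odd 1+m-odd)) (dualℕ-even 1+m-odd)

dualℕ-antitone : ∀ {m₁ m₂} → m₁ ⊑ℕ m₂ → dualℕ m₂ ⊑ℕ dualℕ m₁
dualℕ-antitone {m₂ = zero} (odd⊑even m₁-odd _)
  rewrite dualℕ-odd m₁-odd = even⊑even even-0 m₁-odd z≤n
dualℕ-antitone {m₂ = suc m₂} (odd⊑even m₁-odd 1+m₂-even)
  rewrite dualℕ-odd m₁-odd | dualℕ-even 1+m₂-even = odd⊑even 1+m₂-even m₁-odd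
dualℕ-antitone (odd⊑odd m₁-odd m₂-odd m₂≤m₁)
  rewrite dualℕ-odd m₁-odd | dualℕ-odd m₂-odd = even⊑even m₂-odd m₁-odd (s≤s m₂≤m₁)
dualℕ-antitone {zero} {zero} (even⊑even _ _ _) = even⊑even even-0 even-0 z≤n
dualℕ-antitone {zero} {suc m₂} (even⊑even _ 1+m₂-even _)
  rewrite dualℕ-even 1+m₂-even = odd⊑even 1+m₂-even even-0
dualℕ-antitone {suc m₁} {suc m₂} (even⊑even 1+m₁-even 1+m₂-even (s≤s m₁≤m₂))
  rewrite dualℕ-even 1+m₁-even | dualℕ-even 1+m₂-even = odd⊑odd 1+m₂-even 1+m₁-even m₁≤m₂

-- An odd m ≤ M cannot equal the even M, so its dual m + 1 stays ≤ M.
dualℕ-≤ : ∀ {M m} → Even M → m ≤ M → dualℕ m ≤ M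
dualℕ-≤ {m = m} M-even m≤M with even-or-odd m
... | inj₁ m-even rewrite dualℕ-even m-even = ≤-trans pred[n]≤n m≤M
... | inj₂ m-odd rewrite dualℕ-odd m-odd =
  ≤∧≢⇒< m≤M (λ { refl → even⇒¬odd M-even m-odd })

just-ext : ∀ {A : Set} {x y : Maybe A} →
  (∀ {a} → x ≡ just a → y ≡ just a) → (∀ {a} → y ≡ just a → x ≡ just a) → x ≡ y
just-ext {x = nothing} {nothing} _ _ = refl
just-ext {x = nothing} {just a} _ y⇒x = y⇒x refl
just-ext {x = just a} x⇒y _ = sym (x⇒y refl)

all-nothing-or-just : ∀ {A : Set} n (f : Fin n → Maybe A) →
  (∀ i → f i ≡ nothing) ⊎ ∃₂ λ i a → f i ≡ just a
all-nothing-or-just zero f = inj₁ λ ()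
all-nothing-or-just (suc n) f with f zero in f[0]≡a | all-nothing-or-just n (f ∘ suc)
... | just a  | _ = inj₂ (zero , a , f[0]≡a)
... | nothing | inj₂ (i , a , f[1+i]≡a) = inj₂ (suc i , a , f[1+i]≡a)
... | nothing | inj₁ f∘suc≡⊥ = inj₁ λ { zero → f[0]≡a ; (suc i) → f∘suc≡⊥ i }

≗Q⇒dualQ-≐ : ∀ {n M} {q q' : Query n M} → q ≗Q q' → dualQ q ≐ dualQ q'
≗Q⇒dualQ-≐ q≗q' d = mk⇔ (transport q≗q' d) (transport (λ o → sym (q≗q' o)) d)
  where
  transport : ∀ {r r'} → r ≗Q r' → ∀ d → dualQ r d → dualQ r' d
  transport r≗r' top r≡⊥ o = trans (sym (r≗r' o)) (r≡⊥ o)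
  transport r≗r' (pair o m) (p , r[o]≡p , m≡p*) = p , trans (sym (r≗r' o)) r[o]≡p , m≡p*

module _ {M : ℕ} (M-even : Even M) where

  dualP : Prio M → Prio M
  dualP p = fromℕ< (s≤s (dualℕ-≤ M-even (toℕ≤pred[n] p)))

  toℕ-dualP : ∀ p → toℕ (dualP p) ≡ dualℕ (toℕ p)
  toℕ-dualP p = toℕ-fromℕ< _

  dualP-involutive : ∀ p → dualP (dualP p) ≡ p
  dualP-involutive p = toℕ-injective (begin
    toℕ (dualP (dualP p))  ≡⟨ toℕ-dualP (dualP p) ⟩
    dualℕ (toℕ (dualP p))  ≡⟨ cong dualℕ (toℕ-dualP p) ⟩
    dualℕ (dualℕ (toℕ p))  ≡⟨ dualℕ-involutive (toℕ p) ⟩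
    toℕ p                  ∎)
    where open ≡-Reasoning

  dualP-antitone : ∀ {p p'} → p ⪯P p' → dualP p' ⪯P dualP p
  dualP-antitone {p} {p'} p⪯p' =
    subst₂ _⊑ℕ_ (sym (toℕ-dualP p')) (sym (toℕ-dualP p)) (dualℕ-antitone p⪯p')

  dualP-swapˡ : ∀ {p p'} → dualP p ⪯P p' → dualP p' ⪯P p
  dualP-swapˡ {p} p*⪯p' = subst (_ ⪯P_) (dualP-involutive p) (dualP-antitone p*⪯p')

  dualP-swapʳ : ∀ {p p'} → p ⪯P dualP p' → p' ⪯P dualP p
  dualP-swapʳ {p} {p'} p⪯p'* =
    subst (_⪯P dualP p) (dualP-involutive p') (dualP-antitone p⪯p'*)

  module _ {n : ℕ} (q : Query n M) (o : Exit n) where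

    ∈dualQ-pair : ∀ {m} → dualQ q (pair o m) ⇔ (q o ≡ just (dualP m))
    ∈dualQ-pair {m} = mk⇔
      (λ { (p , q[o]≡p , m≡p*) → subst (λ p → q o ≡ just p) (p≡m* m≡p*) q[o]≡p })
      (λ q[o]≡m* → dualP m , q[o]≡m* , m≡m**)
      where
      open ≡-Reasoning
      m≡m** : toℕ m ≡ dualℕ (toℕ (dualP m))
      m≡m** = begin
        toℕ m                  ≡⟨ sym (dualℕ-involutive (toℕ m)) ⟩
        dualℕ (dualℕ (toℕ m))  ≡⟨ cong dualℕ (sym (toℕ-dualP m)) ⟩
        dualℕ (toℕ (dualP m))  ∎
      p≡m* : ∀ {p} → toℕ m ≡ dualℕ (toℕ p) → p ≡ dualP m
      p≡m* {p} m≡p* = toℕ-injective (begin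
        toℕ p                  ≡⟨ sym (dualℕ-involutive (toℕ p)) ⟩
        dualℕ (dualℕ (toℕ p))  ≡⟨ cong dualℕ (sym m≡p*) ⟩
        dualℕ (toℕ m)          ≡⟨ sym (toℕ-dualP m) ⟩
        toℕ (dualP m)          ∎)

    dualP∈dualQ : ∀ {p} → q o ≡ just p → dualQ q (pair o (dualP p))
    dualP∈dualQ {p} q[o]≡p =
      from ∈dualQ-pair (subst (λ p → q o ≡ just p) (sym (dualP-involutive p)) q[o]≡p)

  dualQ-nonempty : ∀ {n} (q : Query n M) → ∃ (dualQ q)
  dualQ-nonempty {n} q with all-nothing-or-just n q
  ... | inj₁ q≡⊥ = top , q≡⊥
  ... | inj₂ (o , p , q[o]≡p) = pair o (dualP p) , dualP∈dualQ q o q[o]≡p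

  module _ {n : ℕ} {q q' : Query n M} where

    dualQ-≐⇒≗Q : dualQ q ≐ dualQ q' → q ≗Q q'
    dualQ-≐⇒≗Q q*≐q'* o =
      just-ext (just-transfer (to ∘ q*≐q'*)) (just-transfer (from ∘ q*≐q'*))
      where
      just-transfer : ∀ {r r'} → (∀ d → dualQ r d → dualQ r' d) →
                      ∀ {p} → r o ≡ just p → r' o ≡ just p
      just-transfer {r} {r'} r*⊆r'* {p} r[o]≡p =
        trans (to (∈dualQ-pair r' o) (r*⊆r'* _ (dualP∈dualQ r o r[o]≡p)))
              (cong just (dualP-involutive p))

    ⊑Q⇒dualQ-⪯R : q ⊑Q q' → dualQ q' ⪯R dualQ q
    ⊑Q⇒dualQ-⪯R _ top _ = let d , d∈q'* = dualQ-nonempty q' in d , d∈q'* , ≤top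
    ⊑Q⇒dualQ-⪯R q⊑q' (pair o m) pair∈q*
      with q' o in q'[o]≡p' | subst (_⪯P⊥ q' o) (to (∈dualQ-pair q o) pair∈q*) (q⊑q' o)
    ... | just p' | m*⪯p' =
      pair o (dualP p') , dualP∈dualQ q' o q'[o]≡p' , pair≤ (dualP-swapˡ m*⪯p')

    dualQ-⪯R⇒⊑Q : dualQ q' ⪯R dualQ q → q ⊑Q q'
    dualQ-⪯R⇒⊑Q q'*⪯q* o with q o in q[o]≡p
    ... | nothing = tt
    ... | just p with q'*⪯q* (pair o (dualP p)) (dualP∈dualQ q o q[o]≡p)
    ...   | top , _ , ()
    ...   | pair .o m' , pair∈q'* , pair≤ m'⪯p*
      rewrite to (∈dualQ-pair q' o) pair∈q'* = dualP-swapʳ m'⪯p*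

lemma4p10 : (M : ℕ) → 2 ≤ M → 2 ∣ M → (n : ℕ) → (q q' : Query n M) →
    ((q ≗Q q') ⇔ (dualQ q ≐ dualQ q')) × ((q ⊑Q q') ⇔ (dualQ q' ⪯R dualQ q))
lemma4p10 M _ M-even n q q' =
  mk⇔ ≗Q⇒dualQ-≐ (dualQ-≐⇒≗Q M-even) , mk⇔ (⊑Q⇒dualQ-⪯R M-even) (dualQ-⪯R⇒⊑Q M-even)
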